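{- For any $n\geq 1$, $p_{n;\leq n}^n=p_{n-1}$. For any $1\leq s\leq n-1$, $p_{n;\leq s}^s=p_{n-1;\leq s}$.
   Context: There are $n$ parking spaces in a line numbered $1,\dots,n$; $n$ cars arrive in order, car $j$ has preference $a_j\in[n]$ and parks in the first unoccupied space numbered $\geq a_j$, if any; $(a_1,\dots,a_n)$ is a parking function if all cars park. $p_{n}=(n+1)^{n-1}$ is the number of parking functions of length $n$ ($p_0=1$); $p_{n;\leq s}$ is the number with all $a_j\leq s$; $p_{n;\leq s}^l$ is the number with $a_1=l$ and all $a_j\leq s$. -}

module Defs where

open import Data.Nat using (ℕ; zero; suc; _+_; _*_; _^_; _≤?_; _≟_; _∸_)
open import Data.Bool using (Bool; true; false; _∧_; if_then_else_)
open import Data.List using (List; []; _∷_; length; filter; map; concatMap; replicate; upTo)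
open import Data.Bool.ListAction using (all)
open import Data.Maybe using (Maybe; just; nothing)
open import Relation.Nullary.Decidable using (⌊_⌋)

-- Parking spaces 1..n are represented by a list of n occupancy flags
-- (position i of the list, counting from 1, is space i).

-- park a car with preference a (1-based) in the first unoccupied space
-- numbered ≥ a; nothing if there is none.
parkFrom : ℕ → List Bool → Maybe (List Bool)
parkFrom _       []            = nothing
parkFrom (suc (suc a)) (o ∷ os) with parkFrom (suc a) os
... | just os' = just (o ∷ os')
... | nothing  = nothing
parkFrom _ (true ∷ os) with parkFrom 1 os
... | just os' = just (true ∷ os')
... | nothing  = nothing
parkFrom _ (false ∷ os) = just (true ∷ os)

runCars : List ℕ → List Bool → Maybe (List Bool)
runCars []       occ = just occ
runCars (a ∷ as) occ with parkFrom a occ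
... | just occ' = runCars as occ'
... | nothing   = nothing

inRange : ℕ → ℕ → Bool
inRange n a = ⌊ 1 ≤? a ⌋ ∧ ⌊ a ≤? n ⌋

isParkingFunction : ℕ → List ℕ → Bool
isParkingFunction n as with runCars as (replicate n false)
... | just _  = ⌊ length as ≟ n ⌋ ∧ all (inRange n) as
... | nothing = false

seqs : ℕ → ℕ → List (List ℕ)
seqs m zero    = [] ∷ []
seqs m (suc k) = concatMap (λ a → map (a ∷_) (seqs m k)) (map suc (upTo m))

p : ℕ → ℕ
p n = length (filter (λ as → isParkingFunction n as Data.Bool.≟ true) (seqs n n))

p≤ : ℕ → ℕ → ℕ
p≤ n s = length (filter (λ as → (isParkingFunction n as ∧ all (λ a → ⌊ a ≤? s ⌋) as) Data.Bool.≟ true) (seqs n n))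

firstIs : ℕ → List ℕ → Bool
firstIs l []      = false
firstIs l (a ∷ _) = ⌊ a ≟ l ⌋

p≤first : ℕ → ℕ → ℕ → ℕ
p≤first n s l = length (filter (λ as → (isParkingFunction n as ∧ all (λ a → ⌊ a ≤? s ⌋) as ∧ firstIs l as) Data.Bool.≟ true) (seqs n n))

module Submission where

-- The first car, with preference s, parks in space s of the empty lot.
-- Every later car has preference ≤ s, so it reaches space s only by sliding
-- over it; hence the lot with space s occupied behaves exactly like a lot with
-- one space fewer into which an occupied space is inserted at position s.  So
-- (s ∷ r) is a parking function of length n iff r is one of length n-1.

open import Defs
open import Data.Nat using (ℕ; zero; suc; _+_; _≤_; _<_; _∸_; _≤′_; ≤′-refl; ≤′-step; z≤n; s≤s; _≤?_; _≟_)
open import Data.Nat.Properties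
  using (≤-refl; ≤-trans; n≤1+n; m≤n⇒m≤1+n; <⇒≤; <⇒≢; >⇒≢; <⇒≱; ≤⇒≤′; ≤′⇒≤; +-identityʳ; suc-injective)
open import Data.Nat.ListAction using (sum)
open import Data.Nat.ListAction.Properties using (sum-++)
open import Data.Bool using (Bool; true; false; _∧_)
open import Data.Bool.Properties using (∧-zeroʳ; ∧-identityʳ; ∧-conicalˡ; ¬-not; T-≡)
open import Data.Bool.ListAction using (all; and)
open import Data.List using (List; []; _∷_; [_]; _++_; _∷ʳ_; length; filter; map; concatMap; replicate; upTo)
open import Data.List.Properties using (filter-++; length-++; map-++; map-cong; map-cong-local; upTo-∷ʳ; length-replicate)
open import Data.List.Relation.Unary.All as All using (All; []; _∷_)
open import Data.List.Relation.Unary.All.Properties using (all⁺; all⁻)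
open import Data.Maybe using (Maybe; just; nothing; _>>=_)
import Data.Maybe as Maybe
open import Data.Product using (_×_; _,_; proj₂; map₁; map₂)
open import Function using (_∘_; Equivalence; mk⇔)
open import Relation.Nullary using (¬_)
open import Relation.Nullary.Decidable using (⌊_⌋; Dec; isYes≗does; dec-true; dec-false; does-⇔; toWitness; fromWitness)
open import Relation.Binary.PropositionalEquality using (_≡_; refl; sym; trans; cong; cong₂; subst; module ≡-Reasoning)
import Data.Bool

open ≡-Reasoning

⌊⌋-true : ∀ {A : Set} (a? : Dec A) → A → ⌊ a? ⌋ ≡ true
⌊⌋-true a? a = trans (isYes≗does a?) (dec-true a? a)

⌊⌋-false : ∀ {A : Set} (a? : Dec A) → ¬ A → ⌊ a? ⌋ ≡ false
⌊⌋-false a? ¬a = trans (isYes≗does a?) (dec-false a? ¬a)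

≟-suc : ∀ a b → ⌊ suc a ≟ suc b ⌋ ≡ ⌊ a ≟ b ⌋
≟-suc a b = trans (isYes≗does (suc a ≟ suc b))
  (trans (does-⇔ (mk⇔ suc-injective (cong suc)) (suc a ≟ suc b) (a ≟ b)) (sym (isYes≗does (a ≟ b))))

inRange-true : ∀ {n a} → 1 ≤ a → a ≤ n → inRange n a ≡ true
inRange-true {n} {a} 1≤a a≤n = cong₂ _∧_ (⌊⌋-true (1 ≤? a) 1≤a) (⌊⌋-true (a ≤? n) a≤n)

inRange-shift : ∀ {m a} → a ≤ m → inRange (suc m) a ≡ inRange m a
inRange-shift {m} {a} a≤m =
  cong (⌊ 1 ≤? a ⌋ ∧_) (trans (⌊⌋-true (a ≤? suc m) (m≤n⇒m≤1+n a≤m)) (sym (⌊⌋-true (a ≤? m) a≤m)))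

atMost : ℕ → List ℕ → Bool
atMost s = all (λ a → ⌊ a ≤? s ⌋)

atMost-sound : ∀ {s} xs → atMost s xs ≡ true → All (_≤ s) xs
atMost-sound xs e = All.map toWitness (all⁺ _ xs (Equivalence.from T-≡ e))

atMost-complete : ∀ {s xs} → All (_≤ s) xs → atMost s xs ≡ true
atMost-complete bounds = Equivalence.to T-≡ (all⁻ _ (All.map fromWitness bounds))

emptyLot : ℕ → List Bool
emptyLot n = replicate n false

-- `parkFrom` and `runCars` written without `with`, so that they compute by
-- pattern matching alone (the clauses mirror those of `parkFrom`).
park : ℕ → List Bool → Maybe (List Bool)
park _             []           = nothing
park (suc (suc a)) (o ∷ os)     = Maybe.map (o ∷_) (park (suc a) os)
park _             (true ∷ os)  = Maybe.map (true ∷_) (park 1 os)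
park _             (false ∷ os) = just (true ∷ os)

run : List ℕ → List Bool → Maybe (List Bool)
run []       occ = just occ
run (a ∷ as) occ = park a occ >>= run as

parkFrom≡park : ∀ a occ → parkFrom a occ ≡ park a occ
parkFrom≡park _ [] = refl
parkFrom≡park (suc (suc a)) (o ∷ os)
  with parkFrom (suc a) os | park (suc a) os | parkFrom≡park (suc a) os
... | just _  | just _  | refl = refl
... | nothing | nothing | refl = refl
parkFrom≡park zero (true ∷ os) with parkFrom 1 os | park 1 os | parkFrom≡park 1 os
... | just _  | just _  | refl = refl
... | nothing | nothing | refl = refl
parkFrom≡park (suc zero) (true ∷ os) with parkFrom 1 os | park 1 os | parkFrom≡park 1 os
... | just _  | just _  | refl = refl
... | nothing | nothing | refl = refl
parkFrom≡park zero       (false ∷ os) = refl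
parkFrom≡park (suc zero) (false ∷ os) = refl

runCars≡run : ∀ as occ → runCars as occ ≡ run as occ
runCars≡run []       occ = refl
runCars≡run (a ∷ as) occ with parkFrom a occ | park a occ | parkFrom≡park a occ
... | just occ′ | just _  | refl = runCars≡run as occ′
... | nothing   | nothing | refl = refl

park-zero : ∀ occ → park 0 occ ≡ park 1 occ
park-zero []           = refl
park-zero (true ∷ os)  = refl
park-zero (false ∷ os) = refl

-- The lot `occ` with an extra occupied space inserted as space k+1.
insertOccupied : ℕ → List Bool → List Bool
insertOccupied zero    occ      = true ∷ occ
insertOccupied (suc k) []       = true ∷ []
insertOccupied (suc k) (o ∷ os) = o ∷ insertOccupied k os

map-cons-insert : ∀ (o : Bool) k (x : Maybe (List Bool)) →
  Maybe.map (o ∷_) (Maybe.map (insertOccupied k) x) ≡ Maybe.map (insertOccupied (suc k)) (Maybe.map (o ∷_) x)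
map-cons-insert o k (just _) = refl
map-cons-insert o k nothing  = refl

-- A car preferring a space ≤ k+1 just slides over an occupied space
-- inserted at position k+1: parking commutes with the insertion.
park-insert : ∀ k a occ → a ≤ suc k →
  park a (insertOccupied k occ) ≡ Maybe.map (insertOccupied k) (park a occ)
park-insert zero    zero          occ _         = cong (Maybe.map (true ∷_)) (sym (park-zero occ))
park-insert zero    (suc zero)    occ _         = refl
park-insert zero    (suc (suc a)) occ (s≤s ())
park-insert (suc k) zero          []  _         = refl
park-insert (suc k) (suc zero)    []  _         = refl
park-insert (suc k) (suc (suc a)) []  _         = refl
park-insert (suc k) (suc (suc a)) (o ∷ os) (s≤s a≤k) =
  trans (cong (Maybe.map (o ∷_)) (park-insert k (suc a) os a≤k)) (map-cons-insert o k (park (suc a) os))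
park-insert (suc k) zero (true ∷ os) _ =
  trans (cong (Maybe.map (true ∷_)) (park-insert k 1 os (s≤s z≤n))) (map-cons-insert true k (park 1 os))
park-insert (suc k) (suc zero) (true ∷ os) _ =
  trans (cong (Maybe.map (true ∷_)) (park-insert k 1 os (s≤s z≤n))) (map-cons-insert true k (park 1 os))
park-insert (suc k) zero       (false ∷ os) _ = refl
park-insert (suc k) (suc zero) (false ∷ os) _ = refl

run-insert : ∀ k as occ → All (_≤ suc k) as →
  run as (insertOccupied k occ) ≡ Maybe.map (insertOccupied k) (run as occ)
run-insert k []       occ []           = refl
run-insert k (a ∷ as) occ (a≤ ∷ as≤) = begin
  (park a (insertOccupied k occ) >>= run as)                ≡⟨ cong (_>>= run as) (park-insert k a occ a≤) ⟩
  (Maybe.map (insertOccupied k) (park a occ) >>= run as)    ≡⟨ continue (park a occ) ⟩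
  Maybe.map (insertOccupied k) (park a occ >>= run as)      ∎
  where
  continue : ∀ x → (Maybe.map (insertOccupied k) x >>= run as) ≡ Maybe.map (insertOccupied k) (x >>= run as)
  continue (just occ′) = run-insert k as occ′ as≤
  continue nothing     = refl

park-empty : ∀ j m → j ≤ m → park (suc j) (emptyLot (suc m)) ≡ just (insertOccupied j (emptyLot m))
park-empty zero    m       _         = refl
park-empty (suc j) (suc m) (s≤s j≤m) = cong (Maybe.map (false ∷_)) (park-empty j m j≤m)

run-first-car : ∀ {j m r} → j ≤ m → All (_≤ suc j) r →
  run (suc j ∷ r) (emptyLot (suc m)) ≡ Maybe.map (insertOccupied j) (run r (emptyLot m))
run-first-car {j} {m} {r} j≤m r≤ = trans (cong (_>>= run r) (park-empty j m j≤m)) (run-insert j r (emptyLot m) r≤)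

mutual
  park-bound : ∀ a occ {occ′} → park a occ ≡ just occ′ → a ≤ length occ × length occ′ ≡ length occ
  park-bound zero          (false ∷ os) refl = z≤n , refl
  park-bound (suc zero)    (false ∷ os) refl = s≤s z≤n , refl
  park-bound zero          (true ∷ os)  e    = z≤n , proj₂ (park-bound-behind true 1 os e)
  park-bound (suc zero)    (true ∷ os)  e    = s≤s z≤n , proj₂ (park-bound-behind true 1 os e)
  park-bound (suc (suc a)) (o ∷ os)     e    = map₁ s≤s (park-bound-behind o (suc a) os e)

  park-bound-behind : ∀ (o : Bool) a os {occ′} → Maybe.map (o ∷_) (park a os) ≡ just occ′ →
    a ≤ length os × length occ′ ≡ suc (length os)
  park-bound-behind o a os e with park a os in parked
  ... | just os′ with refl ← e = map₂ (cong suc) (park-bound a os parked)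

run-bound : ∀ as occ {r} → run as occ ≡ just r → All (_≤ length occ) as
run-bound []       occ e = []
run-bound (a ∷ as) occ e with park a occ in parked
... | just occ′ with park-bound a occ parked
...   | a≤ , sameSize = a≤ ∷ subst (λ ℓ → All (_≤ ℓ) as) sameSize (run-bound as occ′ e)

verdict : ℕ → List ℕ → Maybe (List Bool) → Bool
verdict n as (just _) = ⌊ length as ≟ n ⌋ ∧ all (inRange n) as
verdict n as nothing  = false

isParkingFunction-verdict : ∀ n as → isParkingFunction n as ≡ verdict n as (run as (emptyLot n))
isParkingFunction-verdict n as
  with runCars as (emptyLot n) | run as (emptyLot n) | runCars≡run as (emptyLot n)
... | just _  | just _  | refl = refl
... | nothing | nothing | refl = refl

isParkingFunction-bound : ∀ n as → isParkingFunction n as ≡ true → All (_≤ n) as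
isParkingFunction-bound n as e =
  from-verdict (run as (emptyLot n)) refl (trans (sym (isParkingFunction-verdict n as)) e)
  where
  from-verdict : ∀ x → run as (emptyLot n) ≡ x → verdict n as x ≡ true → All (_≤ n) as
  from-verdict (just _) ran _ = subst (λ ℓ → All (_≤ ℓ) as) (length-replicate n) (run-bound as (emptyLot n) ran)

isParkingFunction-first-car : ∀ {j m r} → j ≤ m → All (_≤ suc j) r →
  isParkingFunction (suc m) (suc j ∷ r) ≡ isParkingFunction m r
isParkingFunction-first-car {j} {m} {r} j≤m r≤ = begin
  isParkingFunction (suc m) (suc j ∷ r)
    ≡⟨ isParkingFunction-verdict (suc m) (suc j ∷ r) ⟩
  verdict (suc m) (suc j ∷ r) (run (suc j ∷ r) (emptyLot (suc m)))
    ≡⟨ cong (verdict (suc m) (suc j ∷ r)) (run-first-car j≤m r≤) ⟩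
  verdict (suc m) (suc j ∷ r) (Maybe.map (insertOccupied j) (run r (emptyLot m)))
    ≡⟨ shifted (run r (emptyLot m)) refl ⟩
  verdict m r (run r (emptyLot m))
    ≡⟨ sym (isParkingFunction-verdict m r) ⟩
  isParkingFunction m r ∎
  where
  -- if the shorter run succeeds, r fits in m spaces, so the length and
  -- range checks for m+1 and for m agree
  shifted : ∀ x → run r (emptyLot m) ≡ x →
    verdict (suc m) (suc j ∷ r) (Maybe.map (insertOccupied j) x) ≡ verdict m r x
  shifted nothing  _   = refl
  shifted (just _) ran = cong₂ _∧_ (≟-suc (length r) m)
    (trans (cong (_∧ all (inRange (suc m)) r) (inRange-true (s≤s z≤n) (s≤s j≤m)))
           (cong and (map-cong-local (All.map inRange-shift r≤m))))
    where
    r≤m : All (_≤ m) r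
    r≤m = subst (λ ℓ → All (_≤ ℓ) r) (length-replicate m) (run-bound r (emptyLot m) ran)

count : (List ℕ → Bool) → List (List ℕ) → ℕ
count f xs = length (filter (λ x → f x Data.Bool.≟ true) xs)

count-++ : ∀ f xs ys → count f (xs ++ ys) ≡ count f xs + count f ys
count-++ f xs ys = trans (cong length (filter-++ (λ x → f x Data.Bool.≟ true) xs ys)) (length-++ (filter _ xs))

count-map : ∀ f (g : List ℕ → List ℕ) xs → count f (map g xs) ≡ count (f ∘ g) xs
count-map f g []       = refl
count-map f g (x ∷ xs) with f (g x)
... | true  = cong suc (count-map f g xs)
... | false = count-map f g xs

count-cong : ∀ {f g} → (∀ x → f x ≡ g x) → ∀ xs → count f xs ≡ count g xs
count-cong         f≗g []       = refl
count-cong {f} {g} f≗g (x ∷ xs) with f x | g x | f≗g x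
... | true  | true  | refl = cong suc (count-cong f≗g xs)
... | false | false | refl = count-cong f≗g xs

count-none : ∀ {f} → (∀ x → f x ≡ false) → ∀ xs → count f xs ≡ 0
count-none     never []       = refl
count-none {f} never (x ∷ xs) rewrite never x = count-none never xs

range : ℕ → List ℕ
range M = map suc (upTo M)

sumTo : ℕ → (ℕ → ℕ) → ℕ
sumTo M h = sum (map h (range M))

sumTo-suc : ∀ M h → sumTo (suc M) h ≡ sumTo M h + h (suc M)
sumTo-suc M h = begin
  sum (map h (map suc (upTo (suc M))))       ≡⟨ cong (sum ∘ map h ∘ map suc) (sym (upTo-∷ʳ M)) ⟩
  sum (map h (map suc (upTo M ∷ʳ M)))        ≡⟨ cong (sum ∘ map h) (map-++ suc (upTo M) [ M ]) ⟩
  sum (map h (range M ++ [ suc M ]))         ≡⟨ cong sum (map-++ h (range M) [ suc M ]) ⟩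
  sum (map h (range M) ++ [ h (suc M) ])     ≡⟨ sum-++ (map h (range M)) [ h (suc M) ] ⟩
  sumTo M h + (h (suc M) + 0)                ≡⟨ cong (sumTo M h +_) (+-identityʳ (h (suc M))) ⟩
  sumTo M h + h (suc M)                      ∎

sumTo-cong : ∀ M {h g} → (∀ a → h a ≡ g a) → sumTo M h ≡ sumTo M g
sumTo-cong M h≗g = cong sum (map-cong h≗g (range M))

sumTo-zero : ∀ M h → (∀ a → a ≤ M → h a ≡ 0) → sumTo M h ≡ 0
sumTo-zero zero    h vanish = refl
sumTo-zero (suc M) h vanish = trans (sumTo-suc M h)
  (cong₂ _+_ (sumTo-zero M h (λ a a≤M → vanish a (m≤n⇒m≤1+n a≤M))) (vanish (suc M) ≤-refl))

sumTo-extend : ∀ {m M} h → (∀ a → m < a → h a ≡ 0) → m ≤′ M → sumTo M h ≡ sumTo m h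
sumTo-extend h vanish ≤′-refl = refl
sumTo-extend {m} {suc M} h vanish (≤′-step m≤′M) = begin
  sumTo (suc M) h         ≡⟨ sumTo-suc M h ⟩
  sumTo M h + h (suc M)   ≡⟨ cong₂ _+_ (sumTo-extend h vanish m≤′M) (vanish (suc M) (s≤s (≤′⇒≤ m≤′M))) ⟩
  sumTo m h + 0           ≡⟨ +-identityʳ (sumTo m h) ⟩
  sumTo m h               ∎

sumTo-single : ∀ {j M} h → (∀ a → ¬ a ≡ suc j → h a ≡ 0) → suc j ≤ M → sumTo M h ≡ h (suc j)
sumTo-single {j} {M} h vanish s≤M = begin
  sumTo M h                 ≡⟨ sumTo-extend h (λ a s<a → vanish a (>⇒≢ s<a)) (≤⇒≤′ s≤M) ⟩
  sumTo (suc j) h           ≡⟨ sumTo-suc j h ⟩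
  sumTo j h + h (suc j)     ≡⟨ cong (_+ h (suc j)) (sumTo-zero j h (λ a a≤j → vanish a (<⇒≢ (s≤s a≤j)))) ⟩
  h (suc j)                 ∎

count-seqs-suc : ∀ f M ℓ → count f (seqs M (suc ℓ)) ≡ sumTo M (λ a → count (f ∘ (a ∷_)) (seqs M ℓ))
count-seqs-suc f M ℓ = blocks (range M)
  where
  blocks : ∀ xs → count f (concatMap (λ a → map (a ∷_) (seqs M ℓ)) xs)
                ≡ sum (map (λ a → count (f ∘ (a ∷_)) (seqs M ℓ)) xs)
  blocks []       = refl
  blocks (a ∷ xs) = trans (count-++ f (map (a ∷_) (seqs M ℓ)) _)
                          (cong₂ _+_ (count-map f (a ∷_) (seqs M ℓ)) (blocks xs))

count-seqs-first : ∀ {f j M} ℓ → (∀ a xs → ¬ a ≡ suc j → f (a ∷ xs) ≡ false) → suc j ≤ M →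
  count f (seqs M (suc ℓ)) ≡ count (f ∘ (suc j ∷_)) (seqs M ℓ)
count-seqs-first {f} {j} {M} ℓ other s≤M = trans (count-seqs-suc f M ℓ)
  (sumTo-single _ (λ a a≢s → count-none (λ xs → other a xs a≢s) (seqs M ℓ)) s≤M)

count-seqs-restrict : ∀ {m M} f → (∀ xs → f xs ≡ true → All (_≤ m) xs) → m ≤ M →
  ∀ ℓ → count f (seqs M ℓ) ≡ count f (seqs m ℓ)
count-seqs-restrict f bounded m≤M zero = refl
count-seqs-restrict {m} {M} f bounded m≤M (suc ℓ) = begin
  count f (seqs M (suc ℓ))                          ≡⟨ count-seqs-suc f M ℓ ⟩
  sumTo M (λ a → count (f ∘ (a ∷_)) (seqs M ℓ))     ≡⟨ sumTo-cong M tails ⟩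
  sumTo M tailCount                                 ≡⟨ sumTo-extend tailCount beyond (≤⇒≤′ m≤M) ⟩
  sumTo m tailCount                                 ≡⟨ sym (count-seqs-suc f m ℓ) ⟩
  count f (seqs m (suc ℓ))                          ∎
  where
  tailCount : ℕ → ℕ
  tailCount a = count (f ∘ (a ∷_)) (seqs m ℓ)

  tails : ∀ a → count (f ∘ (a ∷_)) (seqs M ℓ) ≡ tailCount a
  tails a = count-seqs-restrict (f ∘ (a ∷_)) (λ xs e → All.tail (bounded (a ∷ xs) e)) m≤M ℓ

  beyond : ∀ a → m < a → tailCount a ≡ 0
  beyond a m<a = count-none (λ xs → ¬-not (λ e → <⇒≱ m<a (All.head (bounded (a ∷ xs) e)))) (seqs m ℓ)

restricted : ℕ → ℕ → List ℕ → Bool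
restricted n s as = isParkingFunction n as ∧ atMost s as

restrictedFirst : ℕ → ℕ → List ℕ → Bool
restrictedFirst n s as = isParkingFunction n as ∧ atMost s as ∧ firstIs s as

restrictedFirst-other : ∀ n s a xs → ¬ a ≡ s → restrictedFirst n s (a ∷ xs) ≡ false
restrictedFirst-other n s a xs a≢s
  rewrite ⌊⌋-false (a ≟ s) a≢s | ∧-zeroʳ (atMost s (a ∷ xs)) = ∧-zeroʳ (isParkingFunction n (a ∷ xs))

restrictedFirst-head : ∀ n s r → restrictedFirst n s (s ∷ r) ≡ (isParkingFunction n (s ∷ r) ∧ atMost s r)
restrictedFirst-head n s r
  rewrite ⌊⌋-true (s ≤? s) ≤-refl | ⌊⌋-true (s ≟ s) refl = cong (isParkingFunction n (s ∷ r) ∧_) (∧-identityʳ (atMost s r))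

restricted-first-car : ∀ {j m} r → j ≤ m →
  (isParkingFunction (suc m) (suc j ∷ r) ∧ atMost (suc j) r) ≡ restricted m (suc j) r
restricted-first-car {j} r j≤m with atMost (suc j) r in bounded
... | true  = cong (_∧ true) (isParkingFunction-first-car j≤m (atMost-sound r bounded))
... | false = trans (∧-zeroʳ _) (sym (∧-zeroʳ _))

first-car-count : ∀ {j m} → j ≤ m → p≤first (suc m) (suc j) (suc j) ≡ p≤ m (suc j)
first-car-count {j} {m} j≤m = begin
  count (restrictedFirst (suc m) (suc j)) (seqs (suc m) (suc m))
    ≡⟨ count-seqs-first m (restrictedFirst-other (suc m) (suc j)) (s≤s j≤m) ⟩
  count (restrictedFirst (suc m) (suc j) ∘ (suc j ∷_)) (seqs (suc m) m)
    ≡⟨ count-cong (λ r → trans (restrictedFirst-head (suc m) (suc j) r) (restricted-first-car r j≤m)) (seqs (suc m) m) ⟩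
  count (restricted m (suc j)) (seqs (suc m) m)
    ≡⟨ count-seqs-restrict (restricted m (suc j)) parking-bounded (n≤1+n m) m ⟩
  count (restricted m (suc j)) (seqs m m) ∎
  where
  parking-bounded : ∀ xs → restricted m (suc j) xs ≡ true → All (_≤ m) xs
  parking-bounded xs e = isParkingFunction-bound m xs (∧-conicalˡ _ _ e)

p≤-unrestricted : ∀ {m s} → m ≤ s → p≤ m s ≡ p m
p≤-unrestricted {m} {s} m≤s = count-cong automatic (seqs m m)
  where
  automatic : ∀ as → restricted m s as ≡ isParkingFunction m as
  automatic as with isParkingFunction m as in parking
  ... | true  = atMost-complete (All.map (λ a≤m → ≤-trans a≤m m≤s) (isParkingFunction-bound m as parking))
  ... | false = refl

corollary2p13 : ((n : ℕ) → 1 ≤ n → p≤first n n n ≡ p (n ∸ 1))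
    × ((n s : ℕ) → 1 ≤ s → s ≤ n ∸ 1 → p≤first n s s ≡ p≤ (n ∸ 1) s)
corollary2p13 = first-is-n , first-is-s
  where
  first-is-n : (n : ℕ) → 1 ≤ n → p≤first n n n ≡ p (n ∸ 1)
  first-is-n (suc m) _ = trans (first-car-count {m} {m} ≤-refl) (p≤-unrestricted (n≤1+n m))

  first-is-s : (n s : ℕ) → 1 ≤ s → s ≤ n ∸ 1 → p≤first n s s ≡ p≤ (n ∸ 1) s
  first-is-s zero    (suc j) _ ()
  first-is-s (suc m) (suc j) _ s≤m = first-car-count {j} {m} (<⇒≤ s≤m)
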